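{- For every integer $m>1$, \[ \lim_{k\to\infty} d\big(S_\mathcal{M}(0,m,k)\big)=1. \]
   Context: $\mathbb{N}=\{0,1,2,\ldots\}$. Let $\mathcal{M}=(m^{j-1})_{j\in\mathbb{N}_+}$ and let $p_\mathcal{M}(n,k)$ be the number of tuples $(x_1,\ldots,x_k)\in\mathbb{N}^k$ with $x_1+mx_2+\cdots+m^{k-1}x_k=n$. For $k\in\mathbb{N}_+$ and $i\in\{0,\ldots,m-1\}$, $S_\mathcal{M}(i,m,k)=\{n\in\mathbb{N}:\ p_\mathcal{M}(n,k)\equiv i\pmod{m}\}$. For $S\subseteq\mathbb{N}$, the asymptotic density is $d(S)=\lim_{n\to\infty}\#(S\cap\{1,\ldots,n\})/n$. -}

module Defs where

open import Data.Nat using (ℕ; zero; suc; _+_; _*_; _∸_; _^_; _≤_; _<_; _≤?_)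
open import Data.Nat.Divisibility using (_∣?_)
open import Data.List using (List; []; _∷_; map; upTo)
open import Relation.Nullary using (yes; no)

-- Number of tuples (x_1,…,x_r) ∈ ℕ^r with x_1 w_1 + … + x_r w_r = n,
-- for a list of weights (w_1,…,w_r), each assumed ≥ 1 (so x ≤ n suffices).
-- countTuples n (w ∷ ws) = Σ_{x=0}^{n} [x*w ≤ n] · countTuples (n ∸ x*w) ws
countTuples : ℕ → List ℕ → ℕ
countTuples zero    []       = 1
countTuples (suc _) []       = 0
countTuples n       (w ∷ ws) = go n
  where
  go : ℕ → ℕ
  term : ℕ → ℕ
  term y with y * w ≤? n
  ... | yes _ = countTuples (n ∸ y * w) ws
  ... | no  _ = 0
  go zero    = term zero
  go (suc x) = term (suc x) + go x

weights : ℕ → ℕ → List ℕ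
weights m k = map (m ^_) (upTo k)

-- p_M(n,k) for M = (m^{j-1})_{j ≥ 1}
pM : ℕ → ℕ → ℕ → ℕ
pM m n k = countTuples n (weights m k)

-- #(S_M(0,m,k) ∩ {1,…,n}) : number of j ∈ {1,…,n} with p_M(j,k) ≡ 0 (mod m)
countS0 : ℕ → ℕ → ℕ → ℕ
countS0 m k zero = 0
countS0 m k (suc n) with m ∣? pM m (suc n) k
... | yes _ = suc (countS0 m k n)
... | no  _ = countS0 m k n

-- Splitting off the coefficient of weight 1 gives p(n, k+1) = Σ_{q ≤ n/m} p(q, k).  Summing this
-- over n ≤ N, each complete block of m consecutive n contributes m copies of one value, so
-- Σ_{q ≤ N} p(q, k) ≡ ∏_{i<k} (1 + d_i) (mod m) for the base-m digits d_i of N.  Hence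
-- p(n, k+1) mod m depends only on n mod m^(k+1): the indicator of S(0,m,k+1) is periodic and
-- has a density.  Moreover m ∤ p(n, k+1) forces the first k digits of n/m to avoid m-1, which
-- leaves at most m (m-1)^k of the m^(k+1) residues, and (m-1)^k / m^k → 0 by Bernoulli's
-- inequality.
{-# OPTIONS --safe #-}
module Submission where

open import Defs
open import Data.Nat using (ℕ; zero; suc; _+_; _*_; _∸_; _≤_; _<_; ∣_-_∣)
open import Data.Product using (_×_; ∃-syntax)

open import Data.List using (List; []; _∷_; map; applyUpTo)
open import Data.List.Relation.Unary.All using (All; []; _∷_)
open import Data.List.Relation.Unary.All.Properties using (map⁺; applyUpTo⁺₂)
open import Data.Nat using (NonZero; >-nonZero; _^_; _≤?_; z≤n; s≤s; _⊔_)
open import Data.Nat.DivMod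
open import Data.Nat.Divisibility
  using ( _∣_; _∣?_; _∣0; ∣-trans; n∣m*n; m∣m*n; ∣m+n∣m⇒∣n; ∣m∸n∣n⇒∣m; >⇒∤
        ; n∣m⇒m%n≡0; m%n≡0⇒n∣m)
open import Data.Nat.Properties
open import Algebra.Properties.CommutativeSemigroup +-commutativeSemigroup using (x∙yz≈y∙xz)
open import Data.Nat.Tactic.RingSolver using (solve-∀)
open import Data.Product using (_,_; map₂)
open import Function using (_∘_; id)
open import Relation.Nullary using (¬_; yes; no; contradiction)
open import Relation.Binary.PropositionalEquality

[m+kn]/n≡m/n+k : ∀ m k n .{{_ : NonZero n}} → (m + k * n) / n ≡ m / n + k
[m+kn]/n≡m/n+k m k n = trans (+-distrib-/-∣ʳ m (n∣m*n k)) (cong (m / n +_) (m*n/n≡m k n))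

[m+kn]/n≡k : ∀ {m} k {n} .{{_ : NonZero n}} → m < n → (m + k * n) / n ≡ k
[m+kn]/n≡k {m} k {n} m<n = trans ([m+kn]/n≡m/n+k m k n) (cong (_+ k) (m<n⇒m/n≡0 m<n))

[m+kn]%n≡m : ∀ {m} k {n} .{{_ : NonZero n}} → m < n → (m + k * n) % n ≡ m
[m+kn]%n≡m {m} k {n} m<n = trans ([m+kn]%n≡m%n m k n) (m<n⇒m%n≡m m<n)

%-cong-*ˡ : ∀ c {a b n} .{{_ : NonZero n}} → a % n ≡ b % n → (c * a) % n ≡ (c * b) % n
%-cong-*ˡ c {a} {b} {n} eq = begin
  (c * a) % n              ≡⟨ %-distribˡ-* c a n ⟩
  ((c % n) * (a % n)) % n  ≡⟨ cong (λ x → ((c % n) * x) % n) eq ⟩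
  ((c % n) * (b % n)) % n  ≡⟨ %-distribˡ-* c b n ⟨
  (c * b) % n              ∎
  where open ≡-Reasoning

d*n+d*m<m*n : ∀ d m n → 2 * d < m → 2 * d < n → d * n + d * m < m * n
d*n+d*m<m*n d m n 2d<m 2d<n = *-cancelˡ-< 2 _ _ (begin-strict
  2 * (d * n + d * m)    ≡⟨ distrib d m n ⟩
  2 * d * n + 2 * d * m  <⟨ +-mono-< (*-monoˡ-< n {{>-nonZero (≤-trans (s≤s z≤n) 2d<n)}} 2d<m)
                                    (*-monoˡ-< m {{>-nonZero (≤-trans (s≤s z≤n) 2d<m)}} 2d<n) ⟩
  m * n + n * m          ≡⟨ double m n ⟩
  2 * (m * n)            ∎)
  where
  open ≤-Reasoning
  distrib : ∀ d m n → 2 * (d * n + d * m) ≡ 2 * d * n + 2 * d * m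
  distrib = solve-∀
  double : ∀ m n → m * n + n * m ≡ 2 * (m * n)
  double = solve-∀

∣-∣-cross : ∀ {p c a b x y B} → ∣ x * p - c * a ∣ ≤ B → ∣ y * p - c * b ∣ ≤ B →
            ∣ x * b - y * a ∣ * p ≤ B * b + B * a
∣-∣-cross {p} {c} {a} {b} {x} {y} {B} hx hy = begin
  ∣ x * b - y * a ∣ * p
    ≡⟨ *-distribʳ-∣-∣ p (x * b) (y * a) ⟩
  ∣ x * b * p - y * a * p ∣
    ≡⟨ cong₂ ∣_-_∣ (swap x b p) (swap y a p) ⟩
  ∣ x * p * b - y * p * a ∣
    ≤⟨ ∣-∣-triangle (x * p * b) (c * a * b) (y * p * a) ⟩
  ∣ x * p * b - c * a * b ∣ + ∣ c * a * b - y * p * a ∣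
    ≡⟨ cong (λ z → ∣ x * p * b - c * a * b ∣ + ∣ z - y * p * a ∣) (swap c a b) ⟩
  ∣ x * p * b - c * a * b ∣ + ∣ c * b * a - y * p * a ∣
    ≡⟨ cong₂ _+_ (*-distribʳ-∣-∣ b (x * p) (c * a)) (*-distribʳ-∣-∣ a (c * b) (y * p)) ⟨
  ∣ x * p - c * a ∣ * b + ∣ c * b - y * p ∣ * a
    ≤⟨ +-mono-≤ (*-monoˡ-≤ b hx) (*-monoˡ-≤ a (≤-trans (≤-reflexive (∣-∣-comm (c * b) (y * p))) hy)) ⟩
  B * b + B * a
    ∎
  where
  open ≤-Reasoning
  swap : ∀ u v w → u * v * w ≡ u * w * v
  swap = solve-∀

bernoulli : ∀ a j → a ^ j * (a + j) ≤ suc a ^ j * a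
bernoulli a zero    = ≤-reflexive (+-identityʳ (a + 0))
bernoulli a (suc j) = begin
  a * a ^ j * (a + suc j)              ≤⟨ m≤m+n _ (a ^ j * j) ⟩
  a * a ^ j * (a + suc j) + a ^ j * j  ≡⟨ expand a (a ^ j) j ⟩
  suc a * (a ^ j * (a + j))            ≤⟨ *-monoʳ-≤ (suc a) (bernoulli a j) ⟩
  suc a * (suc a ^ j * a)              ≡⟨ *-assoc (suc a) (suc a ^ j) a ⟨
  suc a * suc a ^ j * a                ∎
  where
  open ≤-Reasoning
  expand : ∀ a p j → a * p * (a + suc j) + p * j ≡ suc a * (p * (a + j))
  expand = solve-∀

E*a^k<[1+a]^k : ∀ {a} E k → 1 ≤ a → E * a ≤ k → E * a ^ k < suc a ^ k
E*a^k<[1+a]^k {a} E k 1≤a Ea≤k = *-cancelʳ-< a (E * a ^ k) (suc a ^ k) (begin-strict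
  E * a ^ k * a    ≡⟨ rearrange E (a ^ k) a ⟩
  a ^ k * (E * a)  ≤⟨ *-monoʳ-≤ (a ^ k) Ea≤k ⟩
  a ^ k * k        <⟨ *-monoʳ-< (a ^ k) {{m^n≢0 a k {{>-nonZero 1≤a}}}} (m<n+m k 1≤a) ⟩
  a ^ k * (a + k)  ≤⟨ bernoulli a k ⟩
  suc a ^ k * a    ∎)
  where
  open ≤-Reasoning
  rearrange : ∀ E p a → E * p * a ≡ p * (E * a)
  rearrange = solve-∀

∑< : ℕ → (ℕ → ℕ) → ℕ
∑< zero    f = 0
∑< (suc n) f = f n + ∑< n f

syntax ∑< n (λ i → e) = ∑[ i < n ] e

∑-cong : ∀ n {f g : ℕ → ℕ} → (∀ i → i < n → f i ≡ g i) → ∑< n f ≡ ∑< n g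
∑-cong zero    eq = refl
∑-cong (suc n) eq = cong₂ _+_ (eq n ≤-refl) (∑-cong n (λ i i<n → eq i (m<n⇒m<1+n i<n)))

∑-mono : ∀ n {f g : ℕ → ℕ} → (∀ i → i < n → f i ≤ g i) → ∑< n f ≤ ∑< n g
∑-mono zero    le = z≤n
∑-mono (suc n) le = +-mono-≤ (le n ≤-refl) (∑-mono n (λ i i<n → le i (m<n⇒m<1+n i<n)))

∑-const : ∀ n c → ∑[ i < n ] c ≡ n * c
∑-const zero    c = refl
∑-const (suc n) c = cong (c +_) (∑-const n c)

∑-zero : ∀ n {f} → (∀ i → i < n → f i ≡ 0) → ∑< n f ≡ 0
∑-zero n eq = trans (∑-cong n eq) (trans (∑-const n 0) (*-zeroʳ n))

∑-≤ : ∀ n {f c} → (∀ i → i < n → f i ≤ c) → ∑< n f ≤ n * c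
∑-≤ n {c = c} le = ≤-trans (∑-mono n le) (≤-reflexive (∑-const n c))

∑-*ˡ : ∀ c n f → ∑[ i < n ] (c * f i) ≡ c * ∑< n f
∑-*ˡ c zero    f = sym (*-zeroʳ c)
∑-*ˡ c (suc n) f = trans (cong (c * f n +_) (∑-*ˡ c n f)) (sym (*-distribˡ-+ c (f n) (∑< n f)))

∑-+ : ∀ m n f → ∑< (m + n) f ≡ ∑< n f + ∑[ i < m ] f (i + n)
∑-+ zero    n f = sym (+-identityʳ _)
∑-+ (suc m) n f = trans (cong (f (m + n) +_) (∑-+ m n f))
                        (x∙yz≈y∙xz (f (m + n)) (∑< n f) (∑[ i < m ] f (i + n)))

∑-suc : ∀ n f → ∑< (suc n) f ≡ f 0 + ∑[ i < n ] f (suc i)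
∑-suc zero    f = refl
∑-suc (suc n) f = trans (cong (f (suc n) +_) (∑-suc n f))
                        (x∙yz≈y∙xz (f (suc n)) (f 0) (∑[ i < n ] f (suc i)))

∑-reverse : ∀ n f → ∑[ i < n ] f (n ∸ suc i) ≡ ∑< n f
∑-reverse zero    f = refl
∑-reverse (suc n) f = trans (∑-suc n (λ i → f (n ∸ i))) (cong (f n +_) (∑-reverse n f))

∑-monoʳ-≤ : ∀ f {m n} → m ≤ n → ∑< m f ≤ ∑< n f
∑-monoʳ-≤ f {m} {n} m≤n = begin
  ∑< m f                              ≤⟨ m≤m+n (∑< m f) _ ⟩
  ∑< m f + ∑[ i < n ∸ m ] f (i + m)  ≡⟨ ∑-+ (n ∸ m) m f ⟨
  ∑< (n ∸ m + m) f                    ≡⟨ cong (λ k → ∑< k f) (m∸n+n≡m m≤n) ⟩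
  ∑< n f                              ∎
  where open ≤-Reasoning

∑-extend : ∀ f {m n} → m ≤ n → (∀ i → m ≤ i → f i ≡ 0) → ∑< n f ≡ ∑< m f
∑-extend f {m} {n} m≤n vanish = begin
  ∑< n f                              ≡⟨ cong (λ k → ∑< k f) (m∸n+n≡m m≤n) ⟨
  ∑< (n ∸ m + m) f                    ≡⟨ ∑-+ (n ∸ m) m f ⟩
  ∑< m f + ∑[ i < n ∸ m ] f (i + m)
    ≡⟨ cong (∑< m f +_) (∑-zero (n ∸ m) (λ i _ → vanish (i + m) (m≤n+m m i))) ⟩
  ∑< m f + 0                          ≡⟨ +-identityʳ _ ⟩
  ∑< m f                              ∎
  where open ≡-Reasoning

∑-blocks : ∀ q m f → ∑< (q * m) f ≡ ∑[ i < q ] ∑[ r < m ] f (r + i * m)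
∑-blocks zero    m f = refl
∑-blocks (suc q) m f = trans (∑-+ m (q * m) f)
  (trans (+-comm (∑< (q * m) f) _) (cong (∑[ r < m ] f (r + q * m) +_) (∑-blocks q m f)))

zeroIndicator : ℕ → ℕ
zeroIndicator zero    = 1
zeroIndicator (suc _) = 0

nonZeroIndicator : ℕ → ℕ
nonZeroIndicator zero    = 0
nonZeroIndicator (suc _) = 1

zeroIndicator≤1 : ∀ x → zeroIndicator x ≤ 1
zeroIndicator≤1 zero    = ≤-refl
zeroIndicator≤1 (suc _) = z≤n

nonZeroIndicator≤1 : ∀ x → nonZeroIndicator x ≤ 1
nonZeroIndicator≤1 zero    = z≤n
nonZeroIndicator≤1 (suc _) = ≤-refl

zeroIndicator+nonZeroIndicator : ∀ x → zeroIndicator x + nonZeroIndicator x ≡ 1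
zeroIndicator+nonZeroIndicator zero    = refl
zeroIndicator+nonZeroIndicator (suc _) = refl

zeroIndicator-∤ : ∀ {n x} .{{_ : NonZero n}} → ¬ n ∣ x → zeroIndicator (x % n) ≡ 0
zeroIndicator-∤ {n} {x} n∤x with x % n in eq
... | zero  = contradiction (m%n≡0⇒n∣m x n eq) n∤x
... | suc _ = refl

∸-∑-zeroIndicator : ∀ n (g : ℕ → ℕ) →
                    n ∸ ∑[ i < n ] zeroIndicator (g i) ≡ ∑[ i < n ] nonZeroIndicator (g i)
∸-∑-zeroIndicator n g = trans (cong (_∸ Z n) (sym (partition n))) (m+n∸m≡n (Z n) (N n))
  where
  Z N : ℕ → ℕ
  Z n = ∑[ i < n ] zeroIndicator (g i)
  N n = ∑[ i < n ] nonZeroIndicator (g i)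
  interchange : ∀ a b c d → (a + c) + (b + d) ≡ (a + b) + (c + d)
  interchange = solve-∀
  partition : ∀ n → Z n + N n ≡ n
  partition zero    = refl
  partition (suc n) = trans (interchange (zeroIndicator (g n)) (nonZeroIndicator (g n)) (Z n) (N n))
    (cong₂ _+_ (zeroIndicator+nonZeroIndicator (g n)) (partition n))

-- Periodic sequences

Periodic : ℕ → (ℕ → ℕ) → Set
Periodic p f = ∀ i → f (i + p) ≡ f i

periodic-+* : ∀ {p f} → Periodic p f → ∀ i q → f (i + q * p) ≡ f i
periodic-+* {f = f} per i zero    = cong f (+-identityʳ i)
periodic-+* {p} {f} per i (suc q) =
  trans (cong f (regroup i p (q * p))) (trans (per (i + q * p)) (periodic-+* per i q))
  where
  regroup : ∀ i p x → i + (p + x) ≡ i + x + p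
  regroup = solve-∀

∑-periodic : ∀ {p f} → Periodic p f → ∀ s q → ∑< (s + q * p) f ≡ ∑< s f + q * ∑< p f
∑-periodic {p} {f} per s q = begin
  ∑< (s + q * p) f
    ≡⟨ ∑-+ s (q * p) f ⟩
  ∑< (q * p) f + ∑[ i < s ] f (i + q * p)
    ≡⟨ cong₂ _+_ (∑-blocks q p f) (∑-cong s (λ i _ → periodic-+* per i q)) ⟩
  ∑[ i < q ] ∑[ r < p ] f (r + i * p) + ∑< s f
    ≡⟨ cong (_+ ∑< s f) (∑-cong q (λ i _ → ∑-cong p (λ r _ → periodic-+* per r i))) ⟩
  ∑[ i < q ] ∑< p f + ∑< s f
    ≡⟨ cong (_+ ∑< s f) (∑-const q (∑< p f)) ⟩
  q * ∑< p f + ∑< s f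
    ≡⟨ +-comm (q * ∑< p f) (∑< s f) ⟩
  ∑< s f + q * ∑< p f
    ∎
  where open ≡-Reasoning

∑-periodic-suc : ∀ {p f} → Periodic p f → ∑[ i < p ] f (suc i) ≡ ∑< p f
∑-periodic-suc {p} {f} per =
  +-cancelˡ-≡ (f 0) _ _ (trans (sym (∑-suc p f)) (cong (_+ ∑< p f) (per 0)))

∑-periodic-deviation : ∀ {p f} .{{_ : NonZero p}} → Periodic p f → (∀ i → f i ≤ 1) →
                       ∀ n → ∣ ∑< n f * p - ∑< p f * n ∣ ≤ p * p
∑-periodic-deviation {p} {f} per f≤1 n = begin
  ∣ F n * p - c * n ∣
    ≡⟨ cong (λ x → ∣ F x * p - c * x ∣) (m≡m%n+[m/n]*n n p) ⟩
  ∣ F (s + q * p) * p - c * (s + q * p) ∣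
    ≡⟨ cong (λ x → ∣ x * p - c * (s + q * p) ∣) (∑-periodic per s q) ⟩
  ∣ (F s + q * c) * p - c * (s + q * p) ∣
    ≡⟨ cong₂ ∣_-_∣ (expandˡ (F s) q c p) (expandʳ c s q p) ⟩
  ∣ q * c * p + F s * p - (q * c * p + c * s) ∣
    ≡⟨ ∣m+n-m+o∣≡∣n-o∣ (q * c * p) (F s * p) (c * s) ⟩
  ∣ F s * p - c * s ∣
    ≤⟨ ∣m-n∣≤m⊔n (F s * p) (c * s) ⟩
  F s * p ⊔ c * s
    ≤⟨ ⊔-lub (*-monoˡ-≤ p (≤-trans (F≤ s) s≤p)) (*-mono-≤ (F≤ p) s≤p) ⟩
  p * p
    ∎
  where
  open ≤-Reasoning
  F : ℕ → ℕ
  F n = ∑< n f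
  c = F p
  s = n % p
  q = n / p
  s≤p : s ≤ p
  s≤p = <⇒≤ (m%n<n n p)
  F≤ : ∀ n → F n ≤ n
  F≤ n = ≤-trans (∑-≤ n (λ i _ → f≤1 i)) (≤-reflexive (*-identityʳ n))
  expandˡ : ∀ x q c p → (x + q * c) * p ≡ q * c * p + x * p
  expandˡ = solve-∀
  expandʳ : ∀ c s q p → c * (s + q * p) ≡ q * c * p + c * s
  expandʳ = solve-∀

∑-periodic-≤ : ∀ {p f} .{{_ : NonZero p}} → Periodic p f → ∀ n → ∑< n f * p ≤ ∑< p f * (n + p)
∑-periodic-≤ {p} {f} per n = begin
  F n * p            ≡⟨ cong (λ x → F x * p) n≡s+qp ⟩
  F (s + q * p) * p  ≡⟨ cong (_* p) (∑-periodic per s q) ⟩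
  (F s + q * c) * p  ≤⟨ *-monoˡ-≤ p (+-monoˡ-≤ (q * c) (∑-monoʳ-≤ f (<⇒≤ (m%n<n n p)))) ⟩
  (c + q * c) * p    ≡⟨ regroup c q p ⟩
  c * (q * p + p)    ≤⟨ *-monoʳ-≤ c (+-monoˡ-≤ p (≤-trans (m≤n+m (q * p) s) (≤-reflexive (sym n≡s+qp)))) ⟩
  c * (n + p)        ∎
  where
  open ≤-Reasoning
  F : ℕ → ℕ
  F n = ∑< n f
  c = F p
  s = n % p
  q = n / p
  n≡s+qp : n ≡ s + q * p
  n≡s+qp = m≡m%n+[m/n]*n n p
  regroup : ∀ c q p → (c + q * c) * p ≡ c * (q * p + p)
  regroup = solve-∀

∑-periodic-Cauchy : ∀ {p f} .{{_ : NonZero p}} → Periodic p f → (∀ i → f i ≤ 1) → ∀ e →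
  ∃[ N ] ((n n' : ℕ) → suc N ≤ n → suc N ≤ n' → suc e * ∣ ∑< n f * n' - ∑< n' f * n ∣ < n * n')
∑-periodic-Cauchy {p} {f} per f≤1 e = 2 * D , bound
  where
  B = p * p
  D = suc e * B
  bound : (n n' : ℕ) → 2 * D < n → 2 * D < n' → suc e * ∣ ∑< n f * n' - ∑< n' f * n ∣ < n * n'
  bound n n' 2D<n 2D<n' = begin-strict
    suc e * T                ≤⟨ *-monoʳ-≤ (suc e) (m≤m*n T p) ⟩
    suc e * (T * p)          ≤⟨ *-monoʳ-≤ (suc e) cross ⟩
    suc e * (B * n' + B * n) ≡⟨ distrib (suc e) B n' n ⟩
    D * n' + D * n           <⟨ d*n+d*m<m*n D n n' 2D<n 2D<n' ⟩
    n * n'                   ∎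
    where
    open ≤-Reasoning
    T = ∣ ∑< n f * n' - ∑< n' f * n ∣
    cross : T * p ≤ B * n' + B * n
    cross = ∣-∣-cross {p} {∑< p f} {n} {n'} {∑< n f} {∑< n' f} {B}
              (∑-periodic-deviation per f≤1 n) (∑-periodic-deviation per f≤1 n')
    distrib : ∀ s B b a → s * (B * b + B * a) ≡ s * B * b + s * B * a
    distrib = solve-∀

∑-periodic-sparse : ∀ {p f} .{{_ : NonZero p}} → Periodic p f → ∀ e → 2 * (suc e * ∑< p f) < p →
                    ∀ n → p < n → suc e * ∑< n f < n
∑-periodic-sparse {p} {f} per e 2D<p n p<n = *-cancelʳ-< p (suc e * ∑< n f) n (begin-strict
  suc e * ∑< n f * p        ≡⟨ *-assoc (suc e) (∑< n f) p ⟩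
  suc e * (∑< n f * p)      ≤⟨ *-monoʳ-≤ (suc e) (∑-periodic-≤ per n) ⟩
  suc e * (c * (n + p))     ≡⟨ distrib (suc e) c n p ⟩
  D * n + D * p             <⟨ d*n+d*m<m*n D p n 2D<p (<-trans 2D<p p<n) ⟩
  p * n                     ≡⟨ *-comm p n ⟩
  n * p                     ∎)
  where
  open ≤-Reasoning
  c = ∑< p f
  D = suc e * c
  distrib : ∀ s c n p → s * (c * (n + p)) ≡ s * c * n + s * c * p
  distrib = solve-∀

-- countTuples n (w ∷ ws) is computed by helpers term and go local to its where-block, which cannot
-- be named.  tupleTerm repeats term with the same `with`, so the two reduce together; the
-- metavariable go is solved to the local go by unification in countTuples-suc, once `with suc k`
-- has made its arguments distinct variables.
tupleTerm : ℕ → ℕ → List ℕ → ℕ → ℕ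
tupleTerm n w ws y with y * w ≤? n
... | yes _ = countTuples (n ∸ y * w) ws
... | no  _ = 0

tupleTerm-≤ : ∀ n w ws y → y * w ≤ n → tupleTerm n w ws y ≡ countTuples (n ∸ y * w) ws
tupleTerm-≤ n w ws y le with y * w ≤? n
... | yes _  = refl
... | no ¬le = contradiction le ¬le

tupleTerm-≰ : ∀ n w ws y → ¬ y * w ≤ n → tupleTerm n w ws y ≡ 0
tupleTerm-≰ n w ws y ¬le with y * w ≤? n
... | yes le = contradiction le ¬le
... | no  _  = refl

mutual
  go : ℕ → ℕ → List ℕ → ℕ → ℕ
  go = _

  countTuples-suc : ∀ k w ws →
                    countTuples (suc k) (w ∷ ws) ≡ tupleTerm (suc k) w ws (suc k) + go (suc k) w ws k
  countTuples-suc k w ws with suc k * w ≤? suc k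
  ... | yes _ with suc k
  ...   | n = refl
  countTuples-suc k w ws | no _ = refl

go-suc : ∀ n w ws x → go n w ws (suc x) ≡ tupleTerm n w ws (suc x) + go n w ws x
go-suc n w ws x with suc x * w ≤? n
... | yes _ = refl
... | no  _ = refl

go-∑ : ∀ n w ws x → go n w ws x ≡ ∑[ y < suc x ] tupleTerm n w ws y
go-∑ n w ws zero    = sym (+-identityʳ _)
go-∑ n w ws (suc x) = trans (go-suc n w ws x) (cong (tupleTerm n w ws (suc x) +_) (go-∑ n w ws x))

countTuples-∑ : ∀ n w ws → countTuples n (w ∷ ws) ≡ ∑[ y < suc n ] tupleTerm n w ws y
countTuples-∑ zero    w ws = go-∑ 0 w ws 0
countTuples-∑ (suc k) w ws =
  trans (countTuples-suc k w ws) (cong (tupleTerm (suc k) w ws (suc k) +_) (go-∑ (suc k) w ws k))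

countTuples-1∷ : ∀ n ws → countTuples n (1 ∷ ws) ≡ ∑[ j < suc n ] countTuples j ws
countTuples-1∷ n ws = begin
  countTuples n (1 ∷ ws)                 ≡⟨ countTuples-∑ n 1 ws ⟩
  ∑[ y < suc n ] tupleTerm n 1 ws y      ≡⟨ ∑-cong (suc n) unit-term ⟩
  ∑[ y < suc n ] countTuples (n ∸ y) ws  ≡⟨ ∑-reverse (suc n) (λ j → countTuples j ws) ⟩
  ∑[ j < suc n ] countTuples j ws        ∎
  where
  open ≡-Reasoning
  unit-term : ∀ y → y < suc n → tupleTerm n 1 ws y ≡ countTuples (n ∸ y) ws
  unit-term y y<1+n =
    trans (tupleTerm-≤ n 1 ws y (≤-trans (≤-reflexive (*-identityʳ y)) (≤-pred y<1+n)))
          (cong (λ z → countTuples (n ∸ z) ws) (*-identityʳ y))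

-- Representations by powers of m

module Base (m-1 : ℕ) where

  m : ℕ
  m = suc m-1

  ∑-one-multiple : ∀ {g : ℕ → ℕ} → (∀ j → ¬ m ∣ j → g j ≡ 0) → ∀ i {s} → s < m →
                   ∑[ t < suc s ] g (t + i * m) ≡ g (i * m)
  ∑-one-multiple {g} vanish i {zero}  _     = +-identityʳ _
  ∑-one-multiple {g} vanish i {suc s} 1+s<m =
    trans (cong (_+ ∑[ t < suc s ] g (t + i * m)) (vanish (suc s + i * m) m∤))
          (∑-one-multiple vanish i (<-trans (n<1+n s) 1+s<m))
    where
    m∤ : ¬ m ∣ suc s + i * m
    m∤ m∣ = >⇒∤ 1+s<m (∣m+n∣m⇒∣n (subst (m ∣_) (+-comm (suc s) (i * m)) m∣) (n∣m*n i))

  ∑-multiples : ∀ {g : ℕ → ℕ} → (∀ j → ¬ m ∣ j → g j ≡ 0) →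
                ∀ n → ∑< (suc n) g ≡ ∑[ q < suc (n / m) ] g (q * m)
  ∑-multiples {g} vanish n = begin
    ∑< (suc n) g
      ≡⟨ cong (λ x → ∑< (suc x) g) (m≡m%n+[m/n]*n n m) ⟩
    ∑< (suc r + q * m) g
      ≡⟨ ∑-+ (suc r) (q * m) g ⟩
    ∑< (q * m) g + ∑[ t < suc r ] g (t + q * m)
      ≡⟨ cong₂ _+_ (∑-blocks q m g) (∑-one-multiple vanish q (m%n<n n m)) ⟩
    ∑[ i < q ] ∑[ t < m ] g (t + i * m) + g (q * m)
      ≡⟨ cong (_+ g (q * m)) (∑-cong q (λ i _ → ∑-one-multiple vanish i ≤-refl)) ⟩
    ∑[ i < q ] g (i * m) + g (q * m)
      ≡⟨ +-comm (∑[ i < q ] g (i * m)) (g (q * m)) ⟩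
    ∑[ i < suc q ] g (i * m)
      ∎
    where
    open ≡-Reasoning
    r = n % m
    q = n / m

  ∑-quotient : ∀ u q s → s ≤ m → ∑[ j < s + q * m ] u (j / m) ≡ m * ∑< q u + s * u q
  ∑-quotient u q s s≤m = begin
    ∑[ j < s + q * m ] u (j / m)
      ≡⟨ ∑-+ s (q * m) _ ⟩
    ∑[ j < q * m ] u (j / m) + ∑[ t < s ] u ((t + q * m) / m)
      ≡⟨ cong₂ _+_ (∑-blocks q m _) (∑-cong s (λ t t<s → cong u ([m+kn]/n≡k q (≤-trans t<s s≤m)))) ⟩
    ∑[ i < q ] ∑[ r < m ] u ((r + i * m) / m) + ∑[ t < s ] u q
      ≡⟨ cong₂ _+_ (∑-cong q (λ i _ → ∑-cong m (λ r r<m → cong u ([m+kn]/n≡k i r<m))))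
                   (∑-const s (u q)) ⟩
    ∑[ i < q ] ∑[ r < m ] u i + s * u q
      ≡⟨ cong (_+ s * u q) (trans (∑-cong q (λ i _ → ∑-const m (u i))) (∑-*ˡ m q u)) ⟩
    m * ∑< q u + s * u q
      ∎
    where open ≡-Reasoning

  countTuples-scale : ∀ ws → All (1 ≤_) ws → ∀ q →
                      countTuples (q * m) (map (m *_) ws) ≡ countTuples q ws
  countTuples-scale []       []             zero    = refl
  countTuples-scale []       []             (suc q) = refl
  countTuples-scale (w ∷ ws) (1≤w ∷ 1≤ws) q = begin
    countTuples (q * m) (m * w ∷ mws)
      ≡⟨ countTuples-∑ (q * m) (m * w) mws ⟩
    ∑[ y < suc (q * m) ] tupleTerm (q * m) (m * w) mws y
      ≡⟨ ∑-cong (suc (q * m)) (λ y _ → scaled-term y) ⟩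
    ∑[ y < suc (q * m) ] tupleTerm q w ws y
      ≡⟨ ∑-extend (tupleTerm q w ws) (s≤s (m≤m*n q m)) vanish ⟩
    ∑[ y < suc q ] tupleTerm q w ws y
      ≡⟨ countTuples-∑ q w ws ⟨
    countTuples q (w ∷ ws)
      ∎
    where
    open ≡-Reasoning
    mws = map (m *_) ws
    reassoc : ∀ y → y * (m * w) ≡ y * w * m
    reassoc y = trans (cong (y *_) (*-comm m w)) (sym (*-assoc y w m))
    scaled-term : ∀ y → tupleTerm (q * m) (m * w) mws y ≡ tupleTerm q w ws y
    scaled-term y with y * w ≤? q
    ... | yes le = begin
      tupleTerm (q * m) (m * w) mws y
        ≡⟨ tupleTerm-≤ (q * m) (m * w) mws y (≤-trans (≤-reflexive (reassoc y)) (*-monoˡ-≤ m le)) ⟩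
      countTuples (q * m ∸ y * (m * w)) mws
        ≡⟨ cong (λ z → countTuples (q * m ∸ z) mws) (reassoc y) ⟩
      countTuples (q * m ∸ y * w * m) mws
        ≡⟨ cong (λ z → countTuples z mws) (*-distribʳ-∸ m q (y * w)) ⟨
      countTuples ((q ∸ y * w) * m) mws
        ≡⟨ countTuples-scale ws 1≤ws (q ∸ y * w) ⟩
      countTuples (q ∸ y * w) ws
        ∎
    ... | no ¬le = tupleTerm-≰ (q * m) (m * w) mws y
                     (λ le → ¬le (*-cancelʳ-≤ (y * w) q m (subst (_≤ q * m) (reassoc y) le)))
    vanish : ∀ y → suc q ≤ y → tupleTerm q w ws y ≡ 0
    vanish y q<y = tupleTerm-≰ q w ws y (λ le → <⇒≱ q<y (≤-trans (m≤m*n y w {{>-nonZero 1≤w}}) le))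

  countTuples-scale-∤ : ∀ ws n → ¬ m ∣ n → countTuples n (map (m *_) ws) ≡ 0
  countTuples-scale-∤ []       zero    m∤0 = contradiction (m ∣0) m∤0
  countTuples-scale-∤ []       (suc n) _   = refl
  countTuples-scale-∤ (w ∷ ws) n       m∤n =
    trans (countTuples-∑ n (m * w) _) (∑-zero (suc n) (λ y _ → term-zero y))
    where
    term-zero : ∀ y → tupleTerm n (m * w) (map (m *_) ws) y ≡ 0
    term-zero y with y * (m * w) ≤? n
    ... | yes le = countTuples-scale-∤ ws (n ∸ y * (m * w))
                     (λ m∣ → m∤n (∣m∸n∣n⇒∣m m le m∣ (∣-trans (m∣m*n w) (n∣m*n y))))
    ... | no  _  = refl

  weights-suc : ∀ k → weights m (suc k) ≡ 1 ∷ map (m *_) (weights m k)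
  weights-suc k = cong (1 ∷_) (powers-suc id k)
    where
    powers-suc : ∀ (f : ℕ → ℕ) k →
                 map (m ^_) (applyUpTo (suc ∘ f) k) ≡ map (m *_) (map (m ^_) (applyUpTo f k))
    powers-suc f zero    = refl
    powers-suc f (suc k) = cong (m * m ^ f 0 ∷_) (powers-suc (f ∘ suc) k)

  weights-positive : ∀ k → All (1 ≤_) (weights m k)
  weights-positive k = map⁺ (applyUpTo⁺₂ id k (m^n>0 m))

  cumulativePM : ℕ → ℕ → ℕ
  cumulativePM k N = ∑[ q < suc N ] pM m q k

  pM-suc : ∀ n k → pM m n (suc k) ≡ cumulativePM k (n / m)
  pM-suc n k = begin
    pM m n (suc k)
      ≡⟨ cong (countTuples n) (weights-suc k) ⟩
    countTuples n (1 ∷ map (m *_) (weights m k))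
      ≡⟨ countTuples-1∷ n _ ⟩
    ∑[ j < suc n ] countTuples j (map (m *_) (weights m k))
      ≡⟨ ∑-multiples (countTuples-scale-∤ (weights m k)) n ⟩
    ∑[ q < suc (n / m) ] countTuples (q * m) (map (m *_) (weights m k))
      ≡⟨ ∑-cong (suc (n / m)) (λ q _ → countTuples-scale (weights m k) (weights-positive k) q) ⟩
    cumulativePM k (n / m)
      ∎
    where open ≡-Reasoning

  digitProduct : ℕ → ℕ → ℕ
  digitProduct zero    N = 1
  digitProduct (suc k) N = suc (N % m) * digitProduct k (N / m)

  digitProduct-block : ∀ k q {r} → r < m → digitProduct (suc k) (r + q * m) ≡ suc r * digitProduct k q
  digitProduct-block k q r<m =
    cong₂ (λ r q → suc r * digitProduct k q) ([m+kn]%n≡m q r<m) ([m+kn]/n≡k q r<m)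

  m^[1+k]≡m^k*m : ∀ k → m ^ suc k ≡ m ^ k * m
  m^[1+k]≡m^k*m k = *-comm m (m ^ k)

  [n+m^[1+k]]/m≡n/m+m^k : ∀ k n → (n + m ^ suc k) / m ≡ n / m + m ^ k
  [n+m^[1+k]]/m≡n/m+m^k k n =
    trans (cong (λ x → (n + x) / m) (m^[1+k]≡m^k*m k)) ([m+kn]/n≡m/n+k n (m ^ k) m)

  digitProduct-periodic : ∀ k → Periodic (m ^ k) (digitProduct k)
  digitProduct-periodic zero    N = refl
  digitProduct-periodic (suc k) N = cong₂ (λ r d → suc r * d)
    (trans (cong (λ x → (N + x) % m) (m^[1+k]≡m^k*m k)) ([m+kn]%n≡m%n N (m ^ k) m))
    (trans (cong (digitProduct k) ([n+m^[1+k]]/m≡n/m+m^k k N)) (digitProduct-periodic k (N / m)))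

  cumulativePM-zero : ∀ N → cumulativePM 0 N ≡ 1
  cumulativePM-zero zero    = refl
  cumulativePM-zero (suc N) = cumulativePM-zero N

  cumulativePM-mod : ∀ k N → cumulativePM k N % m ≡ digitProduct k N % m
  cumulativePM-mod zero    N = cong (_% m) (cumulativePM-zero N)
  cumulativePM-mod (suc k) N = begin
    cumulativePM (suc k) N % m
      ≡⟨ cong (_% m) (∑-cong (suc N) (λ n _ → pM-suc n k)) ⟩
    (∑[ n < suc N ] C (n / m)) % m
      ≡⟨ cong (λ x → ∑< (suc x) (C ∘ (_/ m)) % m) (m≡m%n+[m/n]*n N m) ⟩
    (∑[ n < suc r + q * m ] C (n / m)) % m
      ≡⟨ cong (_% m) (∑-quotient C q (suc r) (m%n<n N m)) ⟩
    (m * ∑< q C + suc r * C q) % m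
      ≡⟨ %-remove-+ˡ (suc r * C q) {m} (m∣m*n (∑< q C)) ⟩
    (suc r * C q) % m
      ≡⟨ %-cong-*ˡ (suc r) {C q} {digitProduct k q} {m} (cumulativePM-mod k q) ⟩
    (suc r * digitProduct k q) % m
      ∎
    where
    open ≡-Reasoning
    C = cumulativePM k
    r = N % m
    q = N / m

  pM-mod : ∀ n k → pM m n (suc k) % m ≡ digitProduct k (n / m) % m
  pM-mod n k = trans (cong (_% m) (pM-suc n k)) (cumulativePM-mod k (n / m))

  pM-mod-periodic : ∀ k → Periodic (m ^ suc k) (λ n → pM m n (suc k) % m)
  pM-mod-periodic k n = begin
    pM m (n + m ^ suc k) (suc k) % m
      ≡⟨ pM-mod (n + m ^ suc k) k ⟩
    digitProduct k ((n + m ^ suc k) / m) % m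
      ≡⟨ cong (λ x → digitProduct k x % m) ([n+m^[1+k]]/m≡n/m+m^k k n) ⟩
    digitProduct k (n / m + m ^ k) % m
      ≡⟨ cong (_% m) (digitProduct-periodic k (n / m)) ⟩
    digitProduct k (n / m) % m
      ≡⟨ pM-mod n k ⟨
    pM m n (suc k) % m
      ∎
    where open ≡-Reasoning

  -- countS0 counts from 1, hence the shift i ↦ suc i.
  residue : ℕ → ℕ → ℕ
  residue k i = pM m (suc i) k % m

  residue-periodic : ∀ k → Periodic (m ^ suc k) (residue (suc k))
  residue-periodic k i = pM-mod-periodic k (suc i)

  nonZeroIndicator-*-% : ∀ a x → nonZeroIndicator ((a * x) % m) ≤ nonZeroIndicator (x % m)
  nonZeroIndicator-*-% a x with x % m in eq
  ... | zero  = ≤-reflexive (cong nonZeroIndicator (trans (%-cong-*ˡ a eq) (cong (_% m) (*-zeroʳ a))))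
  ... | suc _ = nonZeroIndicator≤1 _

  ∑-nonZeroIndicator-multiples : ∀ x →
    ∑[ r < m ] nonZeroIndicator ((suc r * x) % m) ≤ m-1 * nonZeroIndicator (x % m)
  ∑-nonZeroIndicator-multiples x = begin
    nonZeroIndicator ((m * x) % m) + ∑[ r < m-1 ] χ r
      ≡⟨ cong (λ y → nonZeroIndicator y + ∑[ r < m-1 ] χ r) (trans (cong (_% m) (*-comm m x)) (m*n%n≡0 x m)) ⟩
    ∑[ r < m-1 ] χ r
      ≤⟨ ∑-≤ m-1 (λ r _ → nonZeroIndicator-*-% (suc r) x) ⟩
    m-1 * nonZeroIndicator (x % m)
      ∎
    where
    open ≤-Reasoning
    χ : ℕ → ℕ
    χ r = nonZeroIndicator ((suc r * x) % m)

  nonDivisible-digitProduct-count : ∀ k →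
    ∑[ N < m ^ k ] nonZeroIndicator (digitProduct k N % m) ≤ m-1 ^ k
  nonDivisible-digitProduct-count zero    = ≤-trans (≤-reflexive (+-identityʳ _)) (nonZeroIndicator≤1 _)
  nonDivisible-digitProduct-count (suc k) = begin
    ∑[ N < m ^ suc k ] χ (suc k) N
      ≡⟨ cong (λ x → ∑< x (χ (suc k))) (m^[1+k]≡m^k*m k) ⟩
    ∑[ N < m ^ k * m ] χ (suc k) N
      ≡⟨ ∑-blocks (m ^ k) m (χ (suc k)) ⟩
    ∑[ i < m ^ k ] ∑[ r < m ] χ (suc k) (r + i * m)
      ≡⟨ ∑-cong (m ^ k) (λ i _ → ∑-cong m (λ r r<m →
           cong (λ x → nonZeroIndicator (x % m)) (digitProduct-block k i r<m))) ⟩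
    ∑[ i < m ^ k ] ∑[ r < m ] nonZeroIndicator ((suc r * digitProduct k i) % m)
      ≤⟨ ∑-mono (m ^ k) (λ i _ → ∑-nonZeroIndicator-multiples (digitProduct k i)) ⟩
    ∑[ i < m ^ k ] (m-1 * χ k i)
      ≡⟨ ∑-*ˡ m-1 (m ^ k) (χ k) ⟩
    m-1 * ∑[ i < m ^ k ] χ k i
      ≤⟨ *-monoʳ-≤ m-1 (nonDivisible-digitProduct-count k) ⟩
    m-1 * m-1 ^ k
      ∎
    where
    open ≤-Reasoning
    χ : ℕ → ℕ → ℕ
    χ k N = nonZeroIndicator (digitProduct k N % m)

  nonDivisible-pM-count : ∀ k → ∑[ i < m ^ suc k ] nonZeroIndicator (residue (suc k) i) ≤ m * m-1 ^ k
  nonDivisible-pM-count k = begin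
    ∑[ i < m ^ suc k ] nonZeroIndicator (residue (suc k) i)
      ≡⟨ ∑-periodic-suc (λ i → cong nonZeroIndicator (pM-mod-periodic k i)) ⟩
    ∑[ n < m ^ suc k ] nonZeroIndicator (pM m n (suc k) % m)
      ≡⟨ ∑-cong (m ^ suc k) (λ n _ → cong nonZeroIndicator (pM-mod n k)) ⟩
    ∑[ n < m ^ suc k ] χ (n / m)
      ≡⟨ cong (λ x → ∑< x (χ ∘ (_/ m))) (m^[1+k]≡m^k*m k) ⟩
    ∑[ n < 0 + m ^ k * m ] χ (n / m)
      ≡⟨ ∑-quotient χ (m ^ k) 0 z≤n ⟩
    m * ∑< (m ^ k) χ + 0
      ≡⟨ +-identityʳ _ ⟩
    m * ∑< (m ^ k) χ
      ≤⟨ *-monoʳ-≤ m (nonDivisible-digitProduct-count k) ⟩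
    m * m-1 ^ k
      ∎
    where
    open ≤-Reasoning
    χ : ℕ → ℕ
    χ N = nonZeroIndicator (digitProduct k N % m)

  nonDivisible-mass-small : ∀ e k → 1 ≤ m-1 → 2 * suc e * m-1 ≤ k →
    2 * (suc e * ∑[ i < m ^ suc k ] nonZeroIndicator (residue (suc k) i)) < m ^ suc k
  nonDivisible-mass-small e k 1≤m-1 le = begin-strict
    2 * (suc e * ∑[ i < m ^ suc k ] nonZeroIndicator (residue (suc k) i))
      ≤⟨ *-monoʳ-≤ 2 (*-monoʳ-≤ (suc e) (nonDivisible-pM-count k)) ⟩
    2 * (suc e * (m * m-1 ^ k))
      ≡⟨ rearrange (suc e) m (m-1 ^ k) ⟩
    m * (2 * suc e * m-1 ^ k)
      <⟨ *-monoʳ-< m (E*a^k<[1+a]^k (2 * suc e) k 1≤m-1 le) ⟩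
    m * m ^ k
      ∎
    where
    open ≤-Reasoning
    rearrange : ∀ s m p → 2 * (s * (m * p)) ≡ m * (2 * s * p)
    rearrange = solve-∀

  countS0-∑ : ∀ k n → countS0 m k n ≡ ∑[ i < n ] zeroIndicator (residue k i)
  countS0-∑ k zero    = refl
  countS0-∑ k (suc n) with m ∣? pM m (suc n) k
  ... | yes m∣ = cong₂ _+_ (cong zeroIndicator (sym (n∣m⇒m%n≡0 _ m m∣))) (countS0-∑ k n)
  ... | no  m∤ = trans (countS0-∑ k n)
                       (cong (_+ ∑[ i < n ] zeroIndicator (residue k i)) (sym (zeroIndicator-∤ m∤)))

  countS0-Cauchy : ∀ k e → ∃[ N ] ((n n' : ℕ) → suc N ≤ n → suc N ≤ n' →
                   suc e * ∣ countS0 m (suc k) n * n' - countS0 m (suc k) n' * n ∣ < n * n')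
  countS0-Cauchy k e = map₂ (λ cauchy n n' N<n N<n' →
      subst₂ (λ x y → suc e * ∣ x * n' - y * n ∣ < n * n')
        (sym (countS0-∑ (suc k) n)) (sym (countS0-∑ (suc k) n')) (cauchy n n' N<n N<n'))
    (∑-periodic-Cauchy {m ^ suc k} {zeroIndicator ∘ residue (suc k)} {{m^n≢0 m (suc k)}}
      (cong zeroIndicator ∘ residue-periodic k) (zeroIndicator≤1 ∘ residue (suc k)) e)

  countS0-complement-sparse : ∀ e k → 1 ≤ m-1 → 2 * suc e * m-1 ≤ k →
                              ∀ n → m ^ suc k < n → suc e * (n ∸ countS0 m (suc k) n) < n
  countS0-complement-sparse e k 1≤m-1 le n P<n = subst (λ x → suc e * x < n)
    (trans (sym (∸-∑-zeroIndicator n (residue (suc k)))) (cong (n ∸_) (sym (countS0-∑ (suc k) n))))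
    (∑-periodic-sparse {m ^ suc k} {nonZeroIndicator ∘ residue (suc k)} {{m^n≢0 m (suc k)}}
      (cong nonZeroIndicator ∘ residue-periodic k) e (nonDivisible-mass-small e k 1≤m-1 le) n P<n)

proposition6p16 : (m : ℕ) → 2 ≤ m →
    -- for every k ≥ 1 the density d(S_M(0,m,k)) exists (the ratio sequence is Cauchy)
    ((k : ℕ) → 1 ≤ k → (e : ℕ) → ∃[ N ] ((n n' : ℕ) → suc N ≤ n → suc N ≤ n' →
        suc e * ∣ countS0 m k n * n' - countS0 m k n' * n ∣ < n * n'))
    ×
    -- and lim_{k→∞} d(S_M(0,m,k)) = 1 : for every ε = 1/(e+1) there is K with
    -- d(S_M(0,m,k)) ≥ 1 - ε for all k ≥ K (densities are ≤ 1 automatically)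
    ((e : ℕ) → ∃[ K ] ((k : ℕ) → K ≤ k → 1 ≤ k → ∃[ N ] ((n : ℕ) → suc N ≤ n →
        suc e * (n ∸ countS0 m k n) < n)))
proposition6p16 (suc zero)      (s≤s ())
proposition6p16 (suc (suc m-2)) _ =
    (λ { (suc k) _ → countS0-Cauchy k })
  , λ e → suc (2 * suc e * suc m-2) ,
      λ { (suc k) (s≤s K≤k) _ → m ^ suc k , countS0-complement-sparse e k (s≤s z≤n) K≤k }
  where open Base (suc m-2)
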